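{- Let $q$ be a prime power, $n>1$, let $f$ and $g$ be $q$-polynomials over $\mathbb{F}_{q^n}$, and let $\varphi\in\Gamma\mathrm{L}(2,q^n)$ with companion automorphism $\sigma$ be such that $f_\varphi$ and $g_\varphi$ are defined. Then, for $\lambda\in\mathbb{F}_{q^n}^*$, $g_\varphi(x)=f_\varphi(\lambda^\sigma x)/\lambda^\sigma$ for all $x$ if and only if $g(x)=f(\lambda x)/\lambda$ for all $x$.
   Context: A $q$-polynomial over $\mathbb{F}_{q^n}$ is a polynomial $\sum_{i=0}^{n-1}a_ix^{q^i}$ with coefficients in $\mathbb{F}_{q^n}$. An element $\varphi\in\Gamma\mathrm{L}(2,q^n)$ acts on $\mathbb{F}_{q^n}^2$ by $(x,y)\mapsto(ax^\sigma+by^\sigma,\ cx^\sigma+dy^\sigma)$ with $\begin{pmatrix}a&b\\c&d\end{pmatrix}$ invertible over $\mathbb{F}_{q^n}$ and $\sigma$ a field automorphism of $\mathbb{F}_{q^n}$ (the companion automorphism). For a $q$-polynomial $f$ put $k_f(x)=ax^\sigma+bf(x)^\sigma$ and $h_f(x)=cx^\sigma+df(x)^\sigma$; when $k_f$ is a bijection of $\mathbb{F}_{q^n}$, $f_\varphi$ denotes the $q$-polynomial $h_f\circ k_f^{ -1}$ (whose graph is the image under $\varphi$ of the graph of $f$). -}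

module Defs where

open import Data.Nat using (ℕ; zero; suc; _<_) renaming (_^_ to _^ℕ_)
open import Data.Nat.Primality using (Prime)
open import Data.Fin using (Fin; toℕ) renaming (zero to fzero; suc to fsuc)
open import Data.Product using (Σ; _×_; ∃)
open import Relation.Binary.PropositionalEquality using (_≡_; _≢_)
open import Algebra.Core using (Op₁; Op₂)
open import Algebra.Structures using (IsCommutativeRing)
open import Function.Definitions using (Bijective)

IsPrimePower : ℕ → Set
IsPrimePower q = Σ ℕ λ p → Σ ℕ λ k → Prime p × (0 < k) × (q ≡ p ^ℕ k)

record Field : Set₁ where
  infixl 7 _*_
  infixl 6 _+_
  field
    Carrier : Set
    _+_ _*_ : Op₂ Carrier
    -_      : Op₁ Carrier
    0# 1#   : Carrier
    isCommutativeRing : IsCommutativeRing _≡_ _+_ _*_ -_ 0# 1#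
    0≢1     : 0# ≢ 1#
    -- multiplicative inverse (the value at 0 is irrelevant)
    _⁻¹     : Op₁ Carrier
    ⁻¹-inverseʳ : ∀ x → x ≢ 0# → x * (x ⁻¹) ≡ 1#

module FieldOps (F : Field) where
  open Field F

  _^_ : Carrier → ℕ → Carrier
  x ^ zero  = 1#
  x ^ suc m = x * (x ^ m)

  _/_ : Carrier → Carrier → Carrier
  x / y = x * (y ⁻¹)

  sumFin : (n : ℕ) → (Fin n → Carrier) → Carrier
  sumFin zero    h = 0#
  sumFin (suc m) h = h fzero + sumFin m (λ i → h (fsuc i))

  qpoly : (q n : ℕ) → (Fin n → Carrier) → Carrier → Carrier
  qpoly q n a x = sumFin n (λ i → a i * (x ^ (q ^ℕ toℕ i)))

  record IsFieldAut (σ : Carrier → Carrier) : Set where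
    field
      σ-+ : ∀ x y → σ (x + y) ≡ σ x + σ y
      σ-* : ∀ x y → σ (x * y) ≡ σ x * σ y
      σ-1 : σ 1# ≡ 1#
      σ-bij : Bijective _≡_ _≡_ σ

  kmap : (a b : Carrier) (σ : Carrier → Carrier) → (Carrier → Carrier) → Carrier → Carrier
  kmap a b σ f x = a * σ x + b * σ (f x)

  hmap : (c d : Carrier) (σ : Carrier → Carrier) → (Carrier → Carrier) → Carrier → Carrier
  hmap c d σ f x = c * σ x + d * σ (f x)

  IsInverseOf : (Carrier → Carrier) → (Carrier → Carrier) → Set
  IsInverseOf kinv k = (∀ x → k (kinv x) ≡ x) × (∀ x → kinv (k x) ≡ x)

-- The condition g(x) = f(λx)/λ says
-- that scaling the graph of g by λ lands in the graph of f. Being σ-semilinear, φ carries scaling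
-- by λ to scaling by λ^σ, which gives one direction; conversely φ is injective (its matrix is
-- invertible and σ is injective), so scaled graph points of g_φ pull back to those of g.
module Submission where

open import Defs
open import Data.Nat using (ℕ; _<_; _^_)
open import Data.Fin using (Fin)
open import Data.Product using (_×_; _,_; proj₁; proj₂)
open import Function.Base using (_∘_)
open import Function.Bundles using (_↔_; _⇔_; mk⇔; Equivalence)
open import Function.Definitions using (Injective)
open import Function.Properties.Equivalence using () renaming (sym to ⇔-sym; trans to ⇔-trans)
open import Algebra.Bundles using (CommutativeRing)
open import Algebra.Definitions using (AlmostLeftCancellative)
open import Relation.Binary.PropositionalEquality
  using (_≡_; _≢_; sym; trans; cong; cong₂; module ≡-Reasoning)
import Algebra.Properties.Group as GroupProperties
import Algebra.Properties.Monoid as MonoidProperties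
import Algebra.Properties.CommutativeSemigroup as CommutativeSemigroupProperties

module FieldProperties (F : Field) where
  open Field F
  open FieldOps F
  open ≡-Reasoning

  commutativeRing : CommutativeRing _ _
  commutativeRing = record { isCommutativeRing = isCommutativeRing }

  open CommutativeRing commutativeRing
    using (+-group; +-monoid; *-commutativeSemigroup; *-identityˡ; *-identityʳ;
           distribˡ; distribʳ; *-assoc; +-assoc; +-comm; -‿inverseˡ)
  open GroupProperties +-group using (∙-cancelʳ)
  open CommutativeSemigroupProperties *-commutativeSemigroup using (x∙yz≈y∙xz; xy∙z≈y∙xz)

  *-almostCancelˡ : AlmostLeftCancellative _≡_ 0# _*_
  *-almostCancelˡ x y z x≢0 xy≡xz = begin
    y                  ≡⟨ *-identityˡ y ⟨
    1# * y             ≡⟨ cong (_* y) (⁻¹-inverseʳ x x≢0) ⟨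
    (x * x ⁻¹) * y     ≡⟨ xy∙z≈y∙xz x (x ⁻¹) y ⟩
    x ⁻¹ * (x * y)     ≡⟨ cong (x ⁻¹ *_) xy≡xz ⟩
    x ⁻¹ * (x * z)     ≡⟨ xy∙z≈y∙xz x (x ⁻¹) z ⟨
    (x * x ⁻¹) * z     ≡⟨ cong (_* z) (⁻¹-inverseʳ x x≢0) ⟩
    1# * z             ≡⟨ *-identityˡ z ⟩
    z                  ∎

  *-/-cancel : ∀ {x} → x ≢ 0# → ∀ v → x * (v / x) ≡ v
  *-/-cancel {x} x≢0 v = begin
    x * (v * x ⁻¹)     ≡⟨ x∙yz≈y∙xz x v (x ⁻¹) ⟩
    v * (x * x ⁻¹)     ≡⟨ cong (v *_) (⁻¹-inverseʳ x x≢0) ⟩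
    v * 1#             ≡⟨ *-identityʳ v ⟩
    v                  ∎

  ≡/⇔*≡ : ∀ {x} → x ≢ 0# → ∀ u v → (u ≡ v / x) ⇔ (x * u ≡ v)
  ≡/⇔*≡ {x} x≢0 u v = mk⇔
    (λ u≡v/x → trans (cong (x *_) u≡v/x) (*-/-cancel x≢0 v))
    (λ xu≡v → *-almostCancelˡ x u (v / x) x≢0 (trans xu≡v (sym (*-/-cancel x≢0 v))))

  ScalingOf : Carrier → (Carrier → Carrier) → (Carrier → Carrier) → Set
  ScalingOf l f g = ∀ x → l * g x ≡ f (l * x)

  scaling⇔division : ∀ {l} → l ≢ 0# → ∀ f g → ScalingOf l f g ⇔ (∀ x → g x ≡ f (l * x) / l)
  scaling⇔division l≢0 f g = mk⇔
    (λ scaled x → Equivalence.from (≡/⇔*≡ l≢0 _ _) (scaled x))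
    (λ divided x → Equivalence.to (≡/⇔*≡ l≢0 _ _) (divided x))

  determinant : Carrier → Carrier → Carrier → Carrier → Carrier
  determinant a b c d = a * d + - (b * c)

  determinant+bc≡ad : ∀ a b c d → determinant a b c d + b * c ≡ a * d
  determinant+bc≡ad a b c d = MonoidProperties.cancelʳ +-monoid (-‿inverseˡ (b * c)) (a * d)

  -- The adjugate applied to the system, with the subtracted row moved to the left-hand side.
  adjugate-row₁ : ∀ a b c d u v →
    determinant a b c d * u + b * (c * u + d * v) ≡ d * (a * u + b * v)
  adjugate-row₁ a b c d u v = begin
    Δ * u + b * (c * u + d * v)            ≡⟨ cong (Δ * u +_) (distribˡ b (c * u) (d * v)) ⟩
    Δ * u + (b * (c * u) + b * (d * v))    ≡⟨ +-assoc (Δ * u) _ _ ⟨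
    (Δ * u + b * (c * u)) + b * (d * v)    ≡⟨ cong₂ _+_ (cong (Δ * u +_) (x∙yz≈y∙xz b c u)) (x∙yz≈y∙xz b d v) ⟩
    (Δ * u + c * (b * u)) + d * (b * v)    ≡⟨ cong (λ t → (Δ * u + t) + d * (b * v)) (xy∙z≈y∙xz b c u) ⟨
    (Δ * u + (b * c) * u) + d * (b * v)    ≡⟨ cong (_+ d * (b * v)) (distribʳ u Δ (b * c)) ⟨
    (Δ + b * c) * u + d * (b * v)          ≡⟨ cong (λ t → t * u + d * (b * v)) (determinant+bc≡ad a b c d) ⟩
    (a * d) * u + d * (b * v)              ≡⟨ cong (_+ d * (b * v)) (xy∙z≈y∙xz a d u) ⟩
    d * (a * u) + d * (b * v)              ≡⟨ distribˡ d (a * u) (b * v) ⟨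
    d * (a * u + b * v)                    ∎
    where Δ = determinant a b c d

  adjugate-row₂ : ∀ a b c d u v →
    determinant a b c d * v + c * (a * u + b * v) ≡ a * (c * u + d * v)
  adjugate-row₂ a b c d u v = begin
    Δ * v + c * (a * u + b * v)            ≡⟨ cong (Δ * v +_) (distribˡ c (a * u) (b * v)) ⟩
    Δ * v + (c * (a * u) + c * (b * v))    ≡⟨ cong (Δ * v +_) (+-comm _ _) ⟩
    Δ * v + (c * (b * v) + c * (a * u))    ≡⟨ +-assoc (Δ * v) _ _ ⟨
    (Δ * v + c * (b * v)) + c * (a * u)    ≡⟨ cong (λ t → (Δ * v + t) + c * (a * u)) (xy∙z≈y∙xz b c v) ⟨
    (Δ * v + (b * c) * v) + c * (a * u)    ≡⟨ cong (_+ c * (a * u)) (distribʳ v Δ (b * c)) ⟨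
    (Δ + b * c) * v + c * (a * u)          ≡⟨ cong (λ t → t * v + c * (a * u)) (determinant+bc≡ad a b c d) ⟩
    (a * d) * v + c * (a * u)              ≡⟨ cong₂ _+_ (*-assoc a d v) (x∙yz≈y∙xz c a u) ⟩
    a * (d * v) + a * (c * u)              ≡⟨ +-comm _ _ ⟩
    a * (c * u) + a * (d * v)              ≡⟨ distribˡ a (c * u) (d * v) ⟨
    a * (c * u + d * v)                    ∎
    where Δ = determinant a b c d

  linear-injective : ∀ {a b c d} → determinant a b c d ≢ 0# → ∀ {u v u′ v′} →
    a * u + b * v ≡ a * u′ + b * v′ → c * u + d * v ≡ c * u′ + d * v′ → u ≡ u′ × v ≡ v′
  linear-injective {a} {b} {c} {d} Δ≢0 {u} {v} {u′} {v′} row₁ row₂ =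
    *-almostCancelˡ Δ u u′ Δ≢0 (∙-cancelʳ (b * (c * u + d * v)) (Δ * u) (Δ * u′) (begin
      Δ * u + b * (c * u + d * v)       ≡⟨ adjugate-row₁ a b c d u v ⟩
      d * (a * u + b * v)               ≡⟨ cong (d *_) row₁ ⟩
      d * (a * u′ + b * v′)             ≡⟨ adjugate-row₁ a b c d u′ v′ ⟨
      Δ * u′ + b * (c * u′ + d * v′)    ≡⟨ cong (λ t → Δ * u′ + b * t) row₂ ⟨
      Δ * u′ + b * (c * u + d * v)      ∎)) ,
    *-almostCancelˡ Δ v v′ Δ≢0 (∙-cancelʳ (c * (a * u + b * v)) (Δ * v) (Δ * v′) (begin
      Δ * v + c * (a * u + b * v)       ≡⟨ adjugate-row₂ a b c d u v ⟩
      a * (c * u + d * v)               ≡⟨ cong (a *_) row₂ ⟩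
      a * (c * u′ + d * v′)             ≡⟨ adjugate-row₂ a b c d u′ v′ ⟨
      Δ * v′ + c * (a * u′ + b * v′)    ≡⟨ cong (λ t → Δ * v′ + c * t) row₁ ⟨
      Δ * v′ + c * (a * u + b * v)      ∎))
    where Δ = determinant a b c d

module Semilinear (F : Field) {σ} (σ-aut : FieldOps.IsFieldAut F σ) where
  open Field F
  open FieldOps F
  open FieldProperties F
  open IsFieldAut σ-aut
  open CommutativeRing commutativeRing using (+-group; *-commutativeSemigroup; +-identityˡ; distribˡ)
  open GroupProperties +-group using (identityˡ-unique)
  open CommutativeSemigroupProperties *-commutativeSemigroup using (x∙yz≈y∙xz)
  open ≡-Reasoning

  σ-injective : Injective _≡_ _≡_ σ
  σ-injective = proj₁ σ-bij

  σ-0 : σ 0# ≡ 0#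
  σ-0 = identityˡ-unique (σ 0#) (σ 0#) (trans (sym (σ-+ 0# 0#)) (cong σ (+-identityˡ 0#)))

  σ-nonZero : ∀ {x} → x ≢ 0# → σ x ≢ 0#
  σ-nonZero x≢0 σx≡0 = x≢0 (σ-injective (trans σx≡0 (sym σ-0)))

  semilinear-scale : ∀ p r l x y →
    p * σ (l * x) + r * σ (l * y) ≡ σ l * (p * σ x + r * σ y)
  semilinear-scale p r l x y = begin
    p * σ (l * x) + r * σ (l * y)            ≡⟨ cong₂ (λ s t → p * s + r * t) (σ-* l x) (σ-* l y) ⟩
    p * (σ l * σ x) + r * (σ l * σ y)        ≡⟨ cong₂ _+_ (x∙yz≈y∙xz p (σ l) (σ x)) (x∙yz≈y∙xz r (σ l) (σ y)) ⟩
    σ l * (p * σ x) + σ l * (r * σ y)        ≡⟨ distribˡ (σ l) (p * σ x) (r * σ y) ⟨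
    σ l * (p * σ x + r * σ y)                ∎

  semilinear-injective : ∀ {a b c d} → determinant a b c d ≢ 0# → ∀ {x y x′ y′} →
    a * σ x + b * σ y ≡ a * σ x′ + b * σ y′ → c * σ x + d * σ y ≡ c * σ x′ + d * σ y′ →
    x ≡ x′ × y ≡ y′
  semilinear-injective Δ≢0 row₁ row₂ with linear-injective Δ≢0 row₁ row₂
  ... | σx≡σx′ , σy≡σy′ = σ-injective σx≡σx′ , σ-injective σy≡σy′

  -- hmap is definitionally kmap, so this lemma also covers h_f.
  kmap-scale : ∀ p r {l} f g → ScalingOf l f g →
    ∀ x → σ l * kmap p r σ g x ≡ kmap p r σ f (l * x)
  kmap-scale p r {l} f g scaled x = begin
    σ l * (p * σ x + r * σ (g x))            ≡⟨ semilinear-scale p r l x (g x) ⟨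
    p * σ (l * x) + r * σ (l * g x)          ≡⟨ cong (λ t → p * σ (l * x) + r * σ t) (scaled x) ⟩
    p * σ (l * x) + r * σ (f (l * x))        ∎

  scaling-conjugate : ∀ {a b c d} → determinant a b c d ≢ 0# → ∀ f g {kfinv kginv} →
    IsInverseOf kfinv (kmap a b σ f) → IsInverseOf kginv (kmap a b σ g) → ∀ l →
    ScalingOf l f g ⇔ ScalingOf (σ l) (hmap c d σ f ∘ kfinv) (hmap c d σ g ∘ kginv)
  scaling-conjugate {a} {b} {c} {d} Δ≢0 f g {kfinv} {kginv}
                    (kf∘kfinv , kfinv∘kf) (kg∘kginv , kginv∘kg) l = mk⇔ forward backward
    where
    forward : ScalingOf l f g → ScalingOf (σ l) (hmap c d σ f ∘ kfinv) (hmap c d σ g ∘ kginv)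
    forward scaled y = begin
      σ l * hmap c d σ g x                     ≡⟨ kmap-scale c d f g scaled x ⟩
      hmap c d σ f (l * x)                     ≡⟨ cong (hmap c d σ f) kfinv-σl*y ⟨
      hmap c d σ f (kfinv (σ l * y))           ∎
      where
      x = kginv y
      kfinv-σl*y : kfinv (σ l * y) ≡ l * x
      kfinv-σl*y = begin
        kfinv (σ l * y)                        ≡⟨ cong (λ t → kfinv (σ l * t)) (kg∘kginv y) ⟨
        kfinv (σ l * kmap a b σ g x)           ≡⟨ cong kfinv (kmap-scale a b f g scaled x) ⟩
        kfinv (kmap a b σ f (l * x))           ≡⟨ kfinv∘kf (l * x) ⟩
        l * x                                  ∎

    backward : ScalingOf (σ l) (hmap c d σ f ∘ kfinv) (hmap c d σ g ∘ kginv) → ScalingOf l f g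
    backward scaled x = sym (trans (cong f (sym (proj₁ z-graph-point))) (proj₂ z-graph-point))
      where
      z = kfinv (σ l * kmap a b σ g x)
      kf-z : kmap a b σ f z ≡ a * σ (l * x) + b * σ (l * g x)
      kf-z = trans (kf∘kfinv _) (sym (semilinear-scale a b l x (g x)))
      hf-z : hmap c d σ f z ≡ c * σ (l * x) + d * σ (l * g x)
      hf-z = begin
        hmap c d σ f z                                ≡⟨ scaled (kmap a b σ g x) ⟨
        σ l * hmap c d σ g (kginv (kmap a b σ g x))   ≡⟨ cong (λ t → σ l * hmap c d σ g t) (kginv∘kg x) ⟩
        σ l * hmap c d σ g x                          ≡⟨ semilinear-scale c d l x (g x) ⟨
        c * σ (l * x) + d * σ (l * g x)               ∎
      z-graph-point : z ≡ l * x × f z ≡ l * g x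
      z-graph-point = semilinear-injective Δ≢0 kf-z hf-z

proposition2p5 : (q n : ℕ) → IsPrimePower q → 1 < n →
    (F : Field) → (Field.Carrier F ↔ Fin (q ^ n)) →
    let open Field F
        open FieldOps F
    in (f g : Fin n → Carrier) →
       (a b c d : Carrier) → (a * d + - (b * c)) ≢ 0# →
       (σ : Carrier → Carrier) → IsFieldAut σ →
       (kfinv kginv : Carrier → Carrier) →
       IsInverseOf kfinv (kmap a b σ (qpoly q n f)) →
       IsInverseOf kginv (kmap a b σ (qpoly q n g)) →
       (λ₀ : Carrier) → λ₀ ≢ 0# →
       ((∀ x → hmap c d σ (qpoly q n g) (kginv x)
                ≡ hmap c d σ (qpoly q n f) (kfinv (σ λ₀ * x)) / σ λ₀)
        ⇔ (∀ x → qpoly q n g x ≡ qpoly q n f (λ₀ * x) / λ₀))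
proposition2p5 q n _ _ F _ f g a b c d Δ≢0 σ σ-aut kfinv kginv kf-inverse kg-inverse λ₀ λ₀≢0 =
  ⇔-trans (⇔-sym (scaling⇔division (σ-nonZero λ₀≢0) (hmap c d σ f′ ∘ kfinv) (hmap c d σ g′ ∘ kginv)))
    (⇔-trans (⇔-sym (scaling-conjugate Δ≢0 f′ g′ kf-inverse kg-inverse λ₀))
      (scaling⇔division λ₀≢0 f′ g′))
  where
  open FieldOps F
  open FieldProperties F using (scaling⇔division)
  open Semilinear F σ-aut using (σ-nonZero; scaling-conjugate)
  f′ = qpoly q n f
  g′ = qpoly q n g
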